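{- Let $M$ be a matroid on a finite ground set $S$ with rank function $r$, and let $\Delta$ be a non-void strong pseudo-independence complex over $M$. Then $(S,\Delta,r|_{\Delta})$ is a semimatroid.
   Context: Let $\Delta$ be a simplicial complex over $S$ (a family of subsets of $S$ closed under subsets). $\Delta$ is a pseudo-independence complex over $M$ if whenever $\sigma\in\Delta$, $x\in S\setminus\sigma$ and $r(\sigma\cup\{x\})>r(\sigma)$, then $\sigma\cup\{x\}\in\Delta$. It is a strong pseudo-independence complex over $M$ if in addition, whenever $\sigma\in\Delta$, $x\in S\setminus\sigma$, $r(\sigma\cup\{x\})=r(\sigma)$ and $\sigma\cup\{x\}\in\Delta$, then $x$ is a cone point of $\mathrm{lk}_\sigma(\Delta)=\{\tau:\tau\cap\sigma=\emptyset,\ \tau\cup\sigma\in\Delta\}$, i.e. $\tau\cup\{x\}\in\mathrm{lk}_\sigma(\Delta)$ for all $\tau\in\mathrm{lk}_\sigma(\Delta)$. A semimatroid is a triple $(S,\Delta,r)$ with $\Delta$ a non-void simplicial complex over $S$ and $r:\Delta\to\mathbb{N}$ such that for all $\sigma,\tau\in\Delta$: (i) $0\le r(\sigma)\le|\sigma|$; (ii) $\sigma\subseteq\tau\Rightarrow r(\sigma)\le r(\tau)$; (iii) if $\sigma\cup\tau\in\Delta$ then $r(\sigma)+r(\tau)\ge r(\sigma\cup\tau)+r(\sigma\cap\tau)$; (iv) if $r(\sigma)=r(\sigma\cap\tau)$ then $\sigma\cup\tau\in\Delta$; (v) if $r(\sigma)<r(\tau)$ there is $y\in\tau\setminus\sigma$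 with $\sigma\cup\{y\}\in\Delta$. -}

module Defs where

open import Data.Nat using (ℕ; _≤_; _<_)
open import Data.Fin using (Fin)
open import Data.Fin.Subset using (Subset; _∈_; _∉_; _⊆_; _∪_; _∩_; _─_; ⁅_⁆; ∣_∣; ⊥)
open import Data.Product using (Σ; ∃; _×_)
open import Relation.Binary.PropositionalEquality using (_≡_)

record IsMatroidRank {n : ℕ} (r : Subset n → ℕ) : Set where
  field
    rank-bounded : ∀ A → r A ≤ ∣ A ∣
    rank-mono    : ∀ A B → A ⊆ B → r A ≤ r B
    rank-submod  : ∀ A B → r (A ∪ B) Data.Nat.+ r (A ∩ B) ≤ r A Data.Nat.+ r B

IsSimplicialComplex : {n : ℕ} → (Subset n → Set) → Set
IsSimplicialComplex {n} Δ = ∀ (σ τ : Subset n) → τ ⊆ σ → Δ σ → Δ τ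

NonVoid : {n : ℕ} → (Subset n → Set) → Set
NonVoid {n} Δ = ∃ λ (σ : Subset n) → Δ σ

lk : {n : ℕ} → (Subset n → Set) → Subset n → (Subset n → Set)
lk Δ σ τ = (τ ∩ σ ≡ ⊥) × Δ (τ ∪ σ)

IsConePoint : {n : ℕ} → (Subset n → Set) → Fin n → Set
IsConePoint {n} K x = ∀ (τ : Subset n) → K τ → K (τ ∪ ⁅ x ⁆)

IsPseudoIndependence : {n : ℕ} → (Subset n → ℕ) → (Subset n → Set) → Set
IsPseudoIndependence {n} r Δ =
  IsSimplicialComplex Δ ×
  (∀ (σ : Subset n) (x : Fin n) → Δ σ → x ∉ σ →
     r σ < r (σ ∪ ⁅ x ⁆) → Δ (σ ∪ ⁅ x ⁆))

IsStrongPseudoIndependence : {n : ℕ} → (Subset n → ℕ) → (Subset n → Set) → Set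
IsStrongPseudoIndependence {n} r Δ =
  IsPseudoIndependence r Δ ×
  (∀ (σ : Subset n) (x : Fin n) → Δ σ → x ∉ σ →
     r (σ ∪ ⁅ x ⁆) ≡ r σ → Δ (σ ∪ ⁅ x ⁆) → IsConePoint (lk Δ σ) x)

-- Semimatroid (S, Δ, r) with S = Fin n and r : Δ → ℕ
-- (a rank function defined on faces of Δ, i.e. taking a membership proof).
record IsSemimatroid {n : ℕ} (Δ : Subset n → Set)
                     (r : (σ : Subset n) → Δ σ → ℕ) : Set where
  field
    simplicial : IsSimplicialComplex Δ
    nonvoid    : NonVoid Δ
    ax-i   : ∀ σ (pσ : Δ σ) → r σ pσ ≤ ∣ σ ∣
    ax-ii  : ∀ σ τ (pσ : Δ σ) (pτ : Δ τ) → σ ⊆ τ → r σ pσ ≤ r τ pτ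
    ax-iii : ∀ σ τ (pσ : Δ σ) (pτ : Δ τ) (p∪ : Δ (σ ∪ τ)) (p∩ : Δ (σ ∩ τ)) →
             r (σ ∪ τ) p∪ Data.Nat.+ r (σ ∩ τ) p∩ ≤ r σ pσ Data.Nat.+ r τ pτ
    ax-iv  : ∀ σ τ (pσ : Δ σ) (pτ : Δ τ) (p∩ : Δ (σ ∩ τ)) →
             r σ pσ ≡ r (σ ∩ τ) p∩ → Δ (σ ∪ τ)
    ax-v   : ∀ σ τ (pσ : Δ σ) (pτ : Δ τ) → r σ pσ < r τ pτ →
             ∃ λ (y : Fin n) → (y ∈ τ ─ σ) × Δ (σ ∪ ⁅ y ⁆)

restrict : {n : ℕ} (Δ : Subset n → Set) → (Subset n → ℕ) → (σ : Subset n) → Δ σ → ℕ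
restrict Δ r σ _ = r σ

-- Axioms (i)–(iii) are inherited from the matroid rank function, and (v) holds because an
-- element y of τ with r(σ ∪ y) > r(σ) can be added to σ by pseudo-independence; if there were
-- none, every element of τ would lie in the closure of σ, forcing r(τ) ≤ r(σ ∪ τ) = r(σ).
-- For (iv), put ρ = σ ∩ τ and add the elements x of σ ∖ τ to τ one at a time. Since
-- ρ ∪ x ⊆ σ and r(σ) = r(ρ), we get r(ρ ∪ x) = r(ρ), so by strong pseudo-independence x is a
-- cone point of lk_ρ(Δ); every face containing ρ therefore remains a face after adding x.
module Submission where

open import Defs
open import Data.Nat using (ℕ; _≤_; _<_; _+_)
open import Data.Nat.Properties using (≤-trans; ≤-reflexive; ≤-antisym; ≮⇒≥; <-≤-trans; <-irrefl; _<?_; +-mono-≤; +-monoʳ-≤; +-cancelʳ-≤; module ≤-Reasoning)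
open import Data.Fin using (Fin)
open import Data.Fin.Subset
open import Data.Fin.Subset.Properties
open import Data.Fin.Properties using (any?)
open import Data.List using (List; []; _∷_; allFin)
import Data.List.Membership.Propositional as List
open import Data.List.Membership.Propositional.Properties using (∈-allFin)
open import Data.List.Relation.Unary.Any using (here; there)
open import Data.Product using (Σ; _×_; _,_; proj₁; proj₂)
open import Data.Sum using (inj₁; inj₂)
open import Data.Empty using (⊥-elim)
open import Relation.Nullary using (yes; no)
open import Relation.Nullary.Decidable using (_×-dec_)
open import Relation.Binary.PropositionalEquality using (_≡_; refl; sym; trans; cong; subst; module ≡-Reasoning)

private
  variable
    n : ℕ

∪-lub : {p q s : Subset n} → p ⊆ s → q ⊆ s → p ∪ q ⊆ s
∪-lub {p = p} {q} p⊆s q⊆s x∈p∪q with x∈p∪q⁻ p q x∈p∪q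
... | inj₁ x∈p = p⊆s x∈p
... | inj₂ x∈q = q⊆s x∈q

x∈p⇒⁅x⁆⊆p : {x : Fin n} {p : Subset n} → x ∈ p → ⁅ x ⁆ ⊆ p
x∈p⇒⁅x⁆⊆p {x = x} {p} x∈p y∈⁅x⁆ = subst (_∈ p) (sym (x∈⁅y⁆⇒x≡y x y∈⁅x⁆)) x∈p

∪-monoʳ : (p : Subset n) {q s : Subset n} → q ⊆ s → p ∪ q ⊆ p ∪ s
∪-monoʳ p {s = s} q⊆s = ∪-lub (p⊆p∪q s) (λ x∈q → q⊆p∪q p s (q⊆s x∈q))

p⊆q⇒p∪q≡q : {p q : Subset n} → p ⊆ q → p ∪ q ≡ q
p⊆q⇒p∪q≡q {q = q} p⊆q = ⊆-antisym (∪-lub p⊆q ⊆-refl) (q⊆p∪q _ q)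

p∩∁q∪q≡p∪q : (p q : Subset n) → (p ∩ ∁ q) ∪ q ≡ p ∪ q
p∩∁q∪q≡p∪q p q = begin
  (p ∩ ∁ q) ∪ q         ≡⟨ ∪-distribʳ-∩ q p (∁ q) ⟩
  (p ∪ q) ∩ (∁ q ∪ q)   ≡⟨ cong ((p ∪ q) ∩_) (∪-inverseˡ q) ⟩
  (p ∪ q) ∩ ⊤           ≡⟨ ∩-identityʳ (p ∪ q) ⟩
  p ∪ q                 ∎
  where open ≡-Reasoning

p∩∁q∩q≡⊥ : (p q : Subset n) → (p ∩ ∁ q) ∩ q ≡ ⊥
p∩∁q∩q≡⊥ p q = begin
  (p ∩ ∁ q) ∩ q   ≡⟨ ∩-assoc p (∁ q) q ⟩
  p ∩ (∁ q ∩ q)   ≡⟨ cong (p ∩_) (∩-inverseˡ q) ⟩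
  p ∩ ⊥           ≡⟨ ∩-zeroʳ p ⟩
  ⊥               ∎
  where open ≡-Reasoning

p∪q∪r≡p∪r∪q : (p q r : Subset n) → (p ∪ q) ∪ r ≡ (p ∪ r) ∪ q
p∪q∪r≡p∪r∪q p q r = begin
  (p ∪ q) ∪ r   ≡⟨ ∪-assoc p q r ⟩
  p ∪ (q ∪ r)   ≡⟨ cong (p ∪_) (∪-comm q r) ⟩
  p ∪ (r ∪ q)   ≡⟨ sym (∪-assoc p r q) ⟩
  (p ∪ r) ∪ q   ∎
  where open ≡-Reasoning

subset-induction : (P : Subset n → Set) (B : Subset n) → P ⊥ →
                   (∀ {A x} → x ∈ B → P A → P (A ∪ ⁅ x ⁆)) → P B
subset-induction {n} P B P⊥ step = final (collect (allFin n))
  where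
  Stage : List (Fin n) → Set
  Stage xs = Σ (Subset n) λ A → A ⊆ B × P A × (∀ {x} → x List.∈ xs → x ∈ B → x ∈ A)

  collect : (xs : List (Fin n)) → Stage xs
  collect [] = ⊥ , ⊥⊆ , P⊥ , λ ()
  collect (x ∷ xs) with collect xs | x ∈? B
  ... | A , A⊆B , PA , covers | no x∉B =
    A , A⊆B , PA , λ { (here refl) x∈B → ⊥-elim (x∉B x∈B) ; (there y∈xs) → covers y∈xs }
  ... | A , A⊆B , PA , covers | yes x∈B =
    A ∪ ⁅ x ⁆ , ∪-lub A⊆B (x∈p⇒⁅x⁆⊆p x∈B) , step x∈B PA ,
    λ { (here refl) _ → q⊆p∪q A ⁅ x ⁆ (x∈⁅x⁆ x)
      ; (there y∈xs) y∈B → p⊆p∪q ⁅ x ⁆ (covers y∈xs y∈B) }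

  final : Stage (allFin n) → P B
  final (A , A⊆B , PA , covers) =
    subst P (⊆-antisym A⊆B λ {y} y∈B → covers (∈-allFin y) y∈B) PA

module _ {r : Subset n → ℕ} (M : IsMatroidRank r) where
  open IsMatroidRank M

  rank-∪-≤ : {X Y Z : Subset n} → Z ⊆ X ∩ Y → r X ≤ r Z → r Y ≤ r Z → r (X ∪ Y) ≤ r Z
  rank-∪-≤ {X} {Y} {Z} Z⊆X∩Y rX≤rZ rY≤rZ = +-cancelʳ-≤ (r Z) (r (X ∪ Y)) (r Z) (begin
    r (X ∪ Y) + r Z         ≤⟨ +-monoʳ-≤ (r (X ∪ Y)) (rank-mono Z (X ∩ Y) Z⊆X∩Y) ⟩
    r (X ∪ Y) + r (X ∩ Y)   ≤⟨ rank-submod X Y ⟩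
    r X + r Y               ≤⟨ +-mono-≤ rX≤rZ rY≤rZ ⟩
    r Z + r Z               ∎)
    where open ≤-Reasoning

  rank-∪-spanned : (σ τ : Subset n) → (∀ {y} → y ∈ τ → r (σ ∪ ⁅ y ⁆) ≤ r σ) → r (σ ∪ τ) ≤ r σ
  rank-∪-spanned σ τ spans = subset-induction (λ A → r (σ ∪ A) ≤ r σ) τ
    (≤-reflexive (cong r (∪-identityʳ σ))) add
    where
    open ≤-Reasoning
    add : ∀ {A x} → x ∈ τ → r (σ ∪ A) ≤ r σ → r (σ ∪ (A ∪ ⁅ x ⁆)) ≤ r σ
    add {A} {x} x∈τ rσA≤rσ = begin
      r (σ ∪ (A ∪ ⁅ x ⁆))         ≡⟨ cong r (sym (∪-assoc σ A ⁅ x ⁆)) ⟩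
      r ((σ ∪ A) ∪ ⁅ x ⁆)         ≤⟨ rank-mono _ _ (∪-monoʳ (σ ∪ A) (q⊆p∪q σ ⁅ x ⁆)) ⟩
      r ((σ ∪ A) ∪ (σ ∪ ⁅ x ⁆))   ≤⟨ rank-∪-≤ σ⊆ rσA≤rσ (spans x∈τ) ⟩
      r σ                         ∎
      where
      σ⊆ : σ ⊆ (σ ∪ A) ∩ (σ ∪ ⁅ x ⁆)
      σ⊆ z∈σ = x∈p∩q⁺ (p⊆p∪q A z∈σ , p⊆p∪q ⁅ x ⁆ z∈σ)

  rank-augment : (σ τ : Subset n) → r σ < r τ →
                 Σ (Fin n) λ y → y ∈ τ × y ∉ σ × r σ < r (σ ∪ ⁅ y ⁆)
  rank-augment σ τ rσ<rτ with any? (λ y → (y ∈? τ) ×-dec (r σ <? r (σ ∪ ⁅ y ⁆)))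
  ... | yes (y , y∈τ , rσ<rσy) = y , y∈τ , y∉σ , rσ<rσy
    where
    y∉σ : y ∉ σ
    y∉σ y∈σ = <-irrefl refl (<-≤-trans rσ<rσy
      (rank-mono (σ ∪ ⁅ y ⁆) σ (∪-lub ⊆-refl (x∈p⇒⁅x⁆⊆p y∈σ))))
  ... | no none = ⊥-elim (<-irrefl refl (<-≤-trans rσ<rτ (≤-trans
      (rank-mono τ (σ ∪ τ) (q⊆p∪q σ τ))
      (rank-∪-spanned σ τ λ {y} y∈τ → ≮⇒≥ λ rσ<rσy → none (y , y∈τ , rσ<rσy)))))

extend-by-cone-point : {Δ : Subset n → Set} {ρ F : Subset n} {x : Fin n} →
                       IsConePoint (lk Δ ρ) x → ρ ⊆ F → Δ F → Δ (F ∪ ⁅ x ⁆)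
extend-by-cone-point {Δ = Δ} {ρ} {F} {x} cone ρ⊆F ΔF =
  subst Δ F∖ρ∪x∪ρ≡F∪x (proj₂ (cone (F ∩ ∁ ρ) (p∩∁q∩q≡⊥ F ρ , subst Δ (sym F∖ρ∪ρ≡F) ΔF)))
  where
  open ≡-Reasoning
  F∖ρ∪ρ≡F : (F ∩ ∁ ρ) ∪ ρ ≡ F
  F∖ρ∪ρ≡F = begin
    (F ∩ ∁ ρ) ∪ ρ   ≡⟨ p∩∁q∪q≡p∪q F ρ ⟩
    F ∪ ρ           ≡⟨ ∪-comm F ρ ⟩
    ρ ∪ F           ≡⟨ p⊆q⇒p∪q≡q ρ⊆F ⟩
    F               ∎
  F∖ρ∪x∪ρ≡F∪x : ((F ∩ ∁ ρ) ∪ ⁅ x ⁆) ∪ ρ ≡ F ∪ ⁅ x ⁆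
  F∖ρ∪x∪ρ≡F∪x = begin
    ((F ∩ ∁ ρ) ∪ ⁅ x ⁆) ∪ ρ   ≡⟨ p∪q∪r≡p∪r∪q (F ∩ ∁ ρ) ⁅ x ⁆ ρ ⟩
    ((F ∩ ∁ ρ) ∪ ρ) ∪ ⁅ x ⁆   ≡⟨ cong (_∪ ⁅ x ⁆) F∖ρ∪ρ≡F ⟩
    F ∪ ⁅ x ⁆                 ∎

module _ {r : Subset n → ℕ} {Δ : Subset n → Set} (M : IsMatroidRank r)
         (strong : IsStrongPseudoIndependence r Δ) where
  open IsMatroidRank M
  private
    closed : IsSimplicialComplex Δ
    closed = proj₁ (proj₁ strong)

  ∪-face : (σ τ : Subset n) → Δ σ → Δ τ → r σ ≡ r (σ ∩ τ) → Δ (σ ∪ τ)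
  ∪-face σ τ Δσ Δτ rσ≡rρ = subst Δ τ∪[σ∖τ]≡σ∪τ
    (subset-induction (λ A → Δ (τ ∪ A)) (σ ∩ ∁ τ) (subst Δ (sym (∪-identityʳ τ)) Δτ) add)
    where
    ρ : Subset n
    ρ = σ ∩ τ

    τ∪[σ∖τ]≡σ∪τ : τ ∪ (σ ∩ ∁ τ) ≡ σ ∪ τ
    τ∪[σ∖τ]≡σ∪τ = trans (∪-comm τ (σ ∩ ∁ τ)) (p∩∁q∪q≡p∪q σ τ)

    add : ∀ {A x} → x ∈ σ ∩ ∁ τ → Δ (τ ∪ A) → Δ (τ ∪ (A ∪ ⁅ x ⁆))
    add {A} {x} x∈σ∖τ Δτ∪A =
      subst Δ (∪-assoc τ A ⁅ x ⁆) (extend-by-cone-point {Δ = Δ} cone ρ⊆τ∪A Δτ∪A)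
      where
      x∈σ : x ∈ σ
      x∈σ = proj₁ (x∈p∩q⁻ σ (∁ τ) x∈σ∖τ)
      x∉ρ : x ∉ ρ
      x∉ρ x∈ρ = x∈∁p⇒x∉p (proj₂ (x∈p∩q⁻ σ (∁ τ) x∈σ∖τ)) (p∩q⊆q σ τ x∈ρ)
      ρ⊆σ : ρ ⊆ σ
      ρ⊆σ = p∩q⊆p σ τ
      ρ∪x⊆σ : ρ ∪ ⁅ x ⁆ ⊆ σ
      ρ∪x⊆σ = ∪-lub ρ⊆σ (x∈p⇒⁅x⁆⊆p x∈σ)
      ρ⊆τ∪A : ρ ⊆ τ ∪ A
      ρ⊆τ∪A y∈ρ = p⊆p∪q A (p∩q⊆q σ τ y∈ρ)

      r[ρ∪x]≡rρ : r (ρ ∪ ⁅ x ⁆) ≡ r ρ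
      r[ρ∪x]≡rρ = ≤-antisym
        (≤-trans (rank-mono (ρ ∪ ⁅ x ⁆) σ ρ∪x⊆σ) (≤-reflexive rσ≡rρ))
        (rank-mono ρ (ρ ∪ ⁅ x ⁆) (p⊆p∪q ⁅ x ⁆))

      cone : IsConePoint (lk Δ ρ) x
      cone = proj₂ strong ρ x (closed σ ρ ρ⊆σ Δσ) x∉ρ
               r[ρ∪x]≡rρ (closed σ (ρ ∪ ⁅ x ⁆) ρ∪x⊆σ Δσ)

theorem5p3 : (n : ℕ) (r : Subset n → ℕ) (Δ : Subset n → Set) →
    IsMatroidRank r → NonVoid Δ → IsStrongPseudoIndependence r Δ →
    IsSemimatroid Δ (restrict Δ r)
theorem5p3 n r Δ M nonvoid strong@((closed , pseudo) , _) = record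
  { simplicial = closed
  ; nonvoid    = nonvoid
  ; ax-i       = λ σ _ → rank-bounded σ
  ; ax-ii      = λ σ τ _ _ → rank-mono σ τ
  ; ax-iii     = λ σ τ _ _ _ _ → rank-submod σ τ
  ; ax-iv      = λ σ τ Δσ Δτ _ → ∪-face M strong σ τ Δσ Δτ
  ; ax-v       = augment
  }
  where
  open IsMatroidRank M

  augment : ∀ σ τ → Δ σ → Δ τ → r σ < r τ → Σ (Fin n) λ y → y ∈ τ ─ σ × Δ (σ ∪ ⁅ y ⁆)
  augment σ τ Δσ _ rσ<rτ with rank-augment M σ τ rσ<rτ
  ... | y , y∈τ , y∉σ , rσ<rσy = y , x∈p∧x∉q⇒x∈p─q y∈τ y∉σ , pseudo σ y Δσ y∉σ rσ<rσy
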